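{- For every integer $k\ge 0$, the graph $B_k$ is a series-parallel broadcast graph on $2^k+1$ vertices.
   Context: The binomial tree $BT_0$ is a single vertex (its root); for $k\ge1$, $BT_k$ is obtained from two disjoint copies of $BT_{k-1}$ by adding an edge between their roots, one of which is designated the root of $BT_k$; $BT_k$ has $2^k$ vertices. The graph $B_k$ is obtained from $BT_k$ with root $s$ by adding a new vertex $t$ adjacent to all $2^k$ vertices of $BT_k$. A multigraph is series-parallel (SP) if it can be obtained from $K_2$ by a finite sequence of series extensions (replace an edge $\{x,y\}$ by a new vertex $z$ and edges $\{x,z\},\{z,y\}$) and parallel extensions (add an edge parallel to an existing edge); a simple graph is SP if it is the result of such a sequence with no multiple edges at the end. Broadcasting: initially only an originator holds a message; in each discrete time unit, every informed vertex may inform at most one uninformed neighbor. $b(v,G)$ is the minimum number of time units to inform all vertices from originator $v$, $b(G)=\max_v b(v,G)$, and a connected graph on $n$ vertices is a broadcast graph if $b(G)=\lceil\log_2 n\rceil$. -}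

module Defs where

open import Data.Nat using (ℕ; zero; suc; _+_; _^_; _≤_; _<_)
open import Data.Nat.Logarithm using (⌈log₂_⌉)
open import Data.Fin using (Fin; zero; suc; splitAt; inject₁; fromℕ; toℕ; _≟_)
open import Data.Bool using (Bool; true; false; _∧_; if_then_else_)
open import Data.Sum using (_⊎_; inj₁; inj₂)
open import Data.Product using (Σ; ∃; _×_; _,_)
open import Data.List using (List; []; _∷_; _++_; map)
open import Relation.Binary.PropositionalEquality using (_≡_; _≢_)
open import Relation.Nullary using (¬_; yes; no)
open import Function.Bundles using (_↔_; Inverse)

Graph : ℕ → Set
Graph n = Fin n → Fin n → Bool

-- Binomial trees BT_k on Fin (2 ^ k); the root is the vertex zero.
-- 2 ^ suc k reduces to 2 ^ k + (2 ^ k + 0): the first 2^k vertices form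
-- the first copy (containing the root of BT_{k+1}), the next 2^k vertices
-- form the second copy.

isZero : ∀ {m} → Fin m → Bool
isZero zero    = true
isZero (suc _) = false

halves : ∀ k → Fin (2 ^ suc k) → Fin (2 ^ k) ⊎ Fin (2 ^ k)
halves k x with splitAt (2 ^ k) x
... | inj₁ a = inj₁ a
... | inj₂ b with splitAt (2 ^ k) {0} b
...   | inj₁ c = inj₂ c
...   | inj₂ ()

BT : (k : ℕ) → Graph (2 ^ k)
BT zero    _ _ = false
BT (suc k) x y with halves k x | halves k y
... | inj₁ a | inj₁ b = BT k a b
... | inj₂ a | inj₂ b = BT k a b
... | inj₁ a | inj₂ b = isZero a ∧ isZero b
... | inj₂ a | inj₁ b = isZero a ∧ isZero b

-- B_k on Fin (2 ^ k + 1): vertices of BT_k come first, the last vertex is t.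
B : (k : ℕ) → Graph (2 ^ k + 1)
B k x y with splitAt (2 ^ k) {1} x | splitAt (2 ^ k) {1} y
... | inj₁ a | inj₁ b = BT k a b
... | inj₁ a | inj₂ b = true
... | inj₂ a | inj₁ b = true
... | inj₂ a | inj₂ b = false

-- Series-parallel multigraphs: a multigraph on Fin n is a list of edges
-- (unordered pairs, stored as ordered pairs; order/orientation irrelevant).

Edge : ℕ → Set
Edge n = Fin n × Fin n

liftE : ∀ {n} → Edge n → Edge (suc n)
liftE (x , y) = inject₁ x , inject₁ y

data SP : (n : ℕ) → List (Edge n) → Set where
  k2       : SP 2 ((zero , suc zero) ∷ [])
  series   : ∀ {n} (es₁ es₂ : List (Edge n)) (x y : Fin n) →
             SP n (es₁ ++ (x , y) ∷ es₂) →
             SP (suc n) (map liftE es₁ ++ (inject₁ x , fromℕ n) ∷ (fromℕ n , inject₁ y) ∷ map liftE es₂)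
  parallel : ∀ {n} (es₁ es₂ : List (Edge n)) (e : Edge n) →
             SP n (es₁ ++ e ∷ es₂) →
             SP n (es₁ ++ e ∷ e ∷ es₂)

eqF : ∀ {n} → Fin n → Fin n → Bool
eqF a b with a ≟ b
... | yes _ = true
... | no _  = false

mult : ∀ {n} → List (Edge n) → Fin n → Fin n → ℕ
mult []            a b = 0
mult ((x , y) ∷ es) a b =
  (if (eqF x a ∧ eqF y b) then 1 else (if (eqF x b ∧ eqF y a) then 1 else 0)) + mult es a b

-- A simple graph is SP if it is (isomorphic to) the result of such a
-- sequence ending with no multiple edges: each pair is joined by exactly
-- one edge if adjacent in G and by none otherwise.
IsSP : ∀ {n} → Graph n → Set
IsSP {n} G = Σ (List (Edge n)) λ es → SP n es × Σ (Fin n ↔ Fin n) λ σ →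
  ∀ a b → mult es a b ≡ (if G (Inverse.to σ a) (Inverse.to σ b) then 1 else 0)

data Reach {n} (G : Graph n) (u : Fin n) : Fin n → Set where
  here : Reach G u u
  step : ∀ {w x} → Reach G u w → G w x ≡ true → Reach G u x

Connected : ∀ {n} → Graph n → Set
Connected G = ∀ u v → Reach G u v

-- A broadcast scheme from v finishing within T rounds:
-- time u = round in which u gets informed (v at time 0), parent u = the
-- vertex that calls u.  The caller is an informed neighbour (informed
-- strictly earlier), every vertex makes at most one call per round.

record Scheme {n} (G : Graph n) (v : Fin n) (T : ℕ) : Set where
  field
    time       : Fin n → ℕ
    time-orig  : time v ≡ 0
    time-bound : ∀ u → time u ≤ T
    parent     : Fin n → Fin n
    parent-adj : ∀ u → u ≢ v → G (parent u) u ≡ true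
    parent-earlier : ∀ u → u ≢ v → time (parent u) < time u
    one-call   : ∀ u u' → u ≢ v → u' ≢ v → parent u ≡ parent u' →
                 time u ≡ time u' → u ≡ u'

BroadcastTime : ∀ {n} → Graph n → Fin n → ℕ → Set
BroadcastTime G v m = Scheme G v m × (∀ T → T < m → ¬ Scheme G v T)

BroadcastNumber : ∀ {n} → Graph n → ℕ → Set
BroadcastNumber {n} G m =
  (∀ v → ∃ λ m' → m' ≤ m × BroadcastTime G v m') × (∃ λ v → BroadcastTime G v m)

IsBroadcastGraph : ∀ {n} → Graph n → Set
IsBroadcastGraph {n} G = Connected G × BroadcastNumber G ⌈log₂ n ⌉

-- Series-parallel: list t first and then the tree vertices so that each comes after its
-- tree parent. Every new vertex is adjacent exactly to t and to its parent, which already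
-- form an edge; doubling that edge and subdividing one copy adds the vertex.
--
-- Broadcast graph: since at most 2^T vertices are informed after T rounds and B_k has
-- 2^k + 1 vertices, k + 1 rounds are needed. They suffice from every originator: after one
-- round some tree vertex u and t are both informed. In BT_k = two copies of BT_(k-1), t calls
-- the root of the copy avoiding u, which broadcasts there along the binomial tree in k - 1
-- further rounds, while u and t treat u's copy recursively; so u and t finish within k rounds.
module Submission where

open import Defs
open import Data.Nat using (ℕ; zero; suc; _+_; _∸_; _^_; _≤_; _<_; z≤n; s≤s; s≤s⁻¹; _<?_; ⌈_/2⌉)
open import Data.Nat.Logarithm using (⌈log₂_⌉; ⌈log₂⌈n/2⌉⌉≡⌈log₂n⌉∸1)
open import Data.Nat.Properties
open import Data.Fin using (Fin; zero; suc; splitAt; inject₁; fromℕ; toℕ; _↑ˡ_; _↑ʳ_; fromℕ<)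
  renaming (_≟_ to _≟ᶠ_)
open import Data.Fin.Properties
  using (toℕ-injective; toℕ-↑ˡ; toℕ-↑ʳ; ↑ˡ-injective; ↑ʳ-injective; splitAt-↑ˡ; splitAt-↑ʳ;
         splitAt⁻¹-↑ˡ; splitAt⁻¹-↑ʳ; toℕ<n; fromℕ<-toℕ; toℕ-fromℕ<; toℕ-inject₁; toℕ-fromℕ;
         inject₁-injective; fromℕ≢inject₁; injective⇒≤)
open import Data.Bool using (Bool; true; false; _∧_; if_then_else_)
open import Data.Bool.Properties using (∧-comm; ∧-zeroʳ; ∧-identityʳ)
open import Data.Sum using (_⊎_; inj₁; inj₂; [_,_]′)
import Data.Sum
open import Data.Product using (Σ; _×_; _,_; proj₁; proj₂)
open import Function.Bundles using (_↔_; mk↔ₛ′)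
open import Data.List using (List; []; _∷_; _++_; map)
open import Data.List.Properties using (map-++)
open import Data.Nat.Solver using (module +-*-Solver)
open import Data.Empty using (⊥-elim)
open import Function using (_∘_)
open import Data.Fin.Relation.Unary.Top using (view; ‵fromℕ; ‵inject₁)
open import Relation.Binary.PropositionalEquality
open import Relation.Nullary using (¬_; yes; no)
open import Relation.Nullary.Decidable using (toSum)
open import Relation.Binary.Definitions using (tri<; tri≈; tri>)

-- Binomial trees

left : ∀ k → Fin (2 ^ k) → Fin (2 ^ suc k)
left k a = a ↑ˡ (2 ^ k + 0)

right : ∀ k → Fin (2 ^ k) → Fin (2 ^ suc k)
right k c = 2 ^ k ↑ʳ (c ↑ˡ 0)

halves-left : ∀ k a → halves k (left k a) ≡ inj₁ a
halves-left k a rewrite splitAt-↑ˡ (2 ^ k) a (2 ^ k + 0) = refl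

halves-right : ∀ k c → halves k (right k c) ≡ inj₂ c
halves-right k c rewrite splitAt-↑ʳ (2 ^ k) (2 ^ k + 0) (c ↑ˡ 0) | splitAt-↑ˡ (2 ^ k) c 0 = refl

data Side (k : ℕ) : Fin (2 ^ suc k) → Set where
  onLeft  : ∀ a → Side k (left k a)
  onRight : ∀ c → Side k (right k c)

side : ∀ k x → Side k x
side k x with splitAt (2 ^ k) x in eq
... | inj₁ a = subst (Side k) (splitAt⁻¹-↑ˡ eq) (onLeft a)
... | inj₂ b with splitAt (2 ^ k) {0} b in eq′
...   | inj₁ c =
  subst (Side k) (trans (cong (2 ^ k ↑ʳ_) (splitAt⁻¹-↑ˡ eq′)) (splitAt⁻¹-↑ʳ eq)) (onRight c)

toℕ-left : ∀ k a → toℕ (left k a) ≡ toℕ a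
toℕ-left k a = toℕ-↑ˡ a _

toℕ-right : ∀ k c → toℕ (right k c) ≡ 2 ^ k + toℕ c
toℕ-right k c = trans (toℕ-↑ʳ (2 ^ k) (c ↑ˡ 0)) (cong (2 ^ k +_) (toℕ-↑ˡ c 0))

left-injective : ∀ k {a b} → left k a ≡ left k b → a ≡ b
left-injective k = ↑ˡ-injective _ _ _

right-injective : ∀ k {a b} → right k a ≡ right k b → a ≡ b
right-injective k e = ↑ˡ-injective 0 _ _ (↑ʳ-injective (2 ^ k) _ _ e)

left≢right : ∀ k {a c} → left k a ≢ right k c
left≢right k {a} {c} e = <⇒≢ (≤-trans (toℕ<n a) (m≤m+n _ _))
  (trans (sym (toℕ-left k a)) (trans (cong toℕ e) (toℕ-right k c)))

root : ∀ k → Fin (2 ^ k)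
root zero    = zero
root (suc k) = left k (root k)

toℕ-root : ∀ k → toℕ (root k) ≡ 0
toℕ-root zero    = refl
toℕ-root (suc k) = trans (toℕ-left k (root k)) (toℕ-root k)

isZero-cong-toℕ : ∀ {m n} {x : Fin m} {y : Fin n} → toℕ x ≡ toℕ y → isZero x ≡ isZero y
isZero-cong-toℕ {x = zero}  {zero}  _ = refl
isZero-cong-toℕ {x = suc _} {suc _} _ = refl

isZero-pos : ∀ {m} (x : Fin m) → 0 < toℕ x → isZero x ≡ false
isZero-pos (suc _) _ = refl

isZero⇒toℕ≡0 : ∀ {m} {x : Fin m} → isZero x ≡ true → toℕ x ≡ 0
isZero⇒toℕ≡0 {x = zero} _ = refl

isZero⇒≡root : ∀ k {x} → isZero x ≡ true → x ≡ root k
isZero⇒≡root k z = toℕ-injective (trans (isZero⇒toℕ≡0 z) (sym (toℕ-root k)))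

isZero-left : ∀ k a → isZero (left k a) ≡ isZero a
isZero-left k a = isZero-cong-toℕ (toℕ-left k a)

nonroot-left : ∀ k {a} → isZero (left k a) ≡ false → isZero a ≡ false
nonroot-left k {a} = trans (sym (isZero-left k a))

isZero-right : ∀ k c → isZero (right k c) ≡ false
isZero-right k c = isZero-pos (right k c)
  (subst (0 <_) (sym (toℕ-right k c)) (≤-trans (m^n>0 2 k) (m≤m+n _ _)))

isZero-root : ∀ k → isZero (root k) ≡ true
isZero-root k = isZero-cong-toℕ {y = zero {0}} (toℕ-root k)

BT-left-left : ∀ k a b → BT (suc k) (left k a) (left k b) ≡ BT k a b
BT-left-left k a b rewrite halves-left k a | halves-left k b = refl

BT-left-right : ∀ k a c → BT (suc k) (left k a) (right k c) ≡ isZero a ∧ isZero c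
BT-left-right k a c rewrite halves-left k a | halves-right k c = refl

BT-right-left : ∀ k c a → BT (suc k) (right k c) (left k a) ≡ isZero c ∧ isZero a
BT-right-left k c a rewrite halves-left k a | halves-right k c = refl

BT-right-right : ∀ k a b → BT (suc k) (right k a) (right k b) ≡ BT k a b
BT-right-right k a b rewrite halves-right k a | halves-right k b = refl

BT-sym : ∀ k x y → BT k x y ≡ BT k y x
BT-sym zero    x y = refl
BT-sym (suc k) x y with side k x | side k y
... | onLeft a  | onLeft b  rewrite BT-left-left k a b | BT-left-left k b a = BT-sym k a b
... | onLeft a  | onRight c rewrite BT-left-right k a c | BT-right-left k c a = ∧-comm (isZero a) (isZero c)
... | onRight c | onLeft a  rewrite BT-left-right k a c | BT-right-left k c a = ∧-comm (isZero c) (isZero a)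
... | onRight a | onRight b rewrite BT-right-right k a b | BT-right-right k b a = BT-sym k a b

BT-irrefl : ∀ k x → BT k x x ≡ false
BT-irrefl zero    x = refl
BT-irrefl (suc k) x with side k x
... | onLeft a  rewrite BT-left-left k a a = BT-irrefl k a
... | onRight c rewrite BT-right-right k c c = BT-irrefl k c

-- The root is its own parent; the lemmas below concern non-root vertices, isZero x ≡ false.
treeParent : ∀ k → Fin (2 ^ k) → Fin (2 ^ k)
treeParent zero    x = x
treeParent (suc k) x = [ left k ∘ treeParent k , parentOnRight ]′ (halves k x)
  where
  parentOnRight : Fin (2 ^ k) → Fin (2 ^ suc k)
  parentOnRight c = if isZero c then root (suc k) else right k (treeParent k c)

treeParent-left : ∀ k a → treeParent (suc k) (left k a) ≡ left k (treeParent k a)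
treeParent-left k a rewrite halves-left k a = refl

treeParent-right-root : ∀ k c → isZero c ≡ true → treeParent (suc k) (right k c) ≡ root (suc k)
treeParent-right-root k c z rewrite halves-right k c | z = refl

treeParent-right : ∀ k c → isZero c ≡ false → treeParent (suc k) (right k c) ≡ right k (treeParent k c)
treeParent-right k c z rewrite halves-right k c | z = refl

toℕ-treeParent-< : ∀ k x → isZero x ≡ false → toℕ (treeParent k x) < toℕ x
toℕ-treeParent-< zero    zero ()
toℕ-treeParent-< (suc k) x nz with side k x
... | onLeft a rewrite treeParent-left k a | toℕ-left k (treeParent k a) | toℕ-left k a =
  toℕ-treeParent-< k a (nonroot-left k nz)
... | onRight c with isZero c in z
...   | true  rewrite treeParent-right-root k c z | toℕ-root (suc k) | toℕ-right k c =
  ≤-trans (m^n>0 2 k) (m≤m+n _ _)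
...   | false rewrite treeParent-right k c z | toℕ-right k (treeParent k c) | toℕ-right k c =
  +-monoʳ-< (2 ^ k) (toℕ-treeParent-< k c z)

BT-treeParent : ∀ k x → isZero x ≡ false → BT k (treeParent k x) x ≡ true
BT-treeParent zero    zero ()
BT-treeParent (suc k) x nz with side k x
... | onLeft a rewrite treeParent-left k a | BT-left-left k (treeParent k a) a =
  BT-treeParent k a (nonroot-left k nz)
... | onRight c with isZero c in z
...   | true  rewrite treeParent-right-root k c z | BT-left-right k (root k) c | isZero-root k = z
...   | false rewrite treeParent-right k c z | BT-right-right k (treeParent k c) c = BT-treeParent k c z

IsParent : ∀ k → Fin (2 ^ k) → Fin (2 ^ k) → Set
IsParent k y x = isZero x ≡ false × y ≡ treeParent k x

IsParent-left : ∀ k {a b} → IsParent k a b → IsParent (suc k) (left k a) (left k b)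
IsParent-left k {b = b} (nz , eq) = trans (isZero-left k b) nz , trans (cong (left k) eq) (sym (treeParent-left k b))

IsParent-right : ∀ k {a b} → IsParent k a b → IsParent (suc k) (right k a) (right k b)
IsParent-right k {b = b} (nz , eq) = isZero-right k b , trans (cong (right k) eq) (sym (treeParent-right k b nz))

IsParent-roots : ∀ k {a c} → isZero a ∧ isZero c ≡ true → IsParent (suc k) (left k a) (right k c)
IsParent-roots k {a} {c} z with isZero a in za | isZero c in zc
... | true | true = isZero-right k c , trans (cong (left k) (isZero⇒≡root k za)) (sym (treeParent-right-root k c zc))

BT⇒IsParent : ∀ k y x → BT k y x ≡ true → IsParent k y x ⊎ IsParent k x y
BT⇒IsParent (suc k) y x e with side k y | side k x
... | onLeft a  | onLeft b  rewrite BT-left-left k a b =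
  Data.Sum.map (IsParent-left k) (IsParent-left k) (BT⇒IsParent k a b e)
... | onLeft a  | onRight c rewrite BT-left-right k a c = inj₁ (IsParent-roots k e)
... | onRight c | onLeft a  rewrite BT-right-left k c a = inj₂ (IsParent-roots k (trans (∧-comm (isZero a) (isZero c)) e))
... | onRight a | onRight b rewrite BT-right-right k a b =
  Data.Sum.map (IsParent-right k) (IsParent-right k) (BT⇒IsParent k a b e)

BT-earlier-non-parent : ∀ k a b → toℕ b ≤ toℕ a → b ≢ treeParent k a → BT k a b ≡ false
BT-earlier-non-parent k a b b≤a b≢pa with BT k a b in e
... | false = refl
... | true with BT⇒IsParent k a b e
...   | inj₁ (nz , a≡pb) =
  ⊥-elim (<⇒≱ (subst (λ c → toℕ c < toℕ b) (sym a≡pb) (toℕ-treeParent-< k b nz)) b≤a)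
...   | inj₂ (_ , b≡pa)  = ⊥-elim (b≢pa b≡pa)

-- Broadcasting in BT_k

rootTime : ∀ k → Fin (2 ^ k) → ℕ
rootTime zero    _ = 0
rootTime (suc k) x = [ timeOnLeft , suc ∘ rootTime k ]′ (halves k x)
  where
  timeOnLeft : Fin (2 ^ k) → ℕ
  timeOnLeft a = if isZero a then 0 else suc (rootTime k a)

rootTime-left : ∀ k a → rootTime (suc k) (left k a) ≡ (if isZero a then 0 else suc (rootTime k a))
rootTime-left k a rewrite halves-left k a = refl

rootTime-left-nonroot : ∀ k a → isZero a ≡ false → rootTime (suc k) (left k a) ≡ suc (rootTime k a)
rootTime-left-nonroot k a nz rewrite rootTime-left k a | nz = refl

rootTime-right : ∀ k c → rootTime (suc k) (right k c) ≡ suc (rootTime k c)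
rootTime-right k c rewrite halves-right k c = refl

rootTime-root : ∀ k → rootTime k (root k) ≡ 0
rootTime-root zero    = refl
rootTime-root (suc k) rewrite rootTime-left k (root k) | isZero-root k = refl

rootTime-≤ : ∀ k x → rootTime k x ≤ k
rootTime-≤ zero    x = z≤n
rootTime-≤ (suc k) x with side k x
... | onRight c rewrite rootTime-right k c = s≤s (rootTime-≤ k c)
... | onLeft a rewrite rootTime-left k a with isZero a
...   | true  = z≤n
...   | false = s≤s (rootTime-≤ k a)

rootTime-pos : ∀ k x → isZero x ≡ false → 0 < rootTime k x
rootTime-pos zero    zero ()
rootTime-pos (suc k) x nz with side k x
... | onLeft a rewrite rootTime-left-nonroot k a (nonroot-left k nz) = s≤s z≤n
... | onRight c rewrite rootTime-right k c = s≤s z≤n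

rootTime-treeParent-< : ∀ k x → isZero x ≡ false → rootTime k (treeParent k x) < rootTime k x
rootTime-treeParent-< zero    zero ()
rootTime-treeParent-< (suc k) x nz with side k x
... | onLeft a rewrite treeParent-left k a | rootTime-left-nonroot k a (nonroot-left k nz)
                     | rootTime-left k (treeParent k a) with isZero (treeParent k a)
...   | true  = s≤s z≤n
...   | false = s≤s (rootTime-treeParent-< k a (nonroot-left k nz))
rootTime-treeParent-< (suc k) x nz | onRight c with isZero c in z
...   | true  rewrite treeParent-right-root k c z | rootTime-root (suc k) | rootTime-right k c = s≤s z≤n
...   | false rewrite treeParent-right k c z | rootTime-right k (treeParent k c) | rootTime-right k c =
  s≤s (rootTime-treeParent-< k c z)

rootTime-left≢right-root : ∀ k a c → isZero a ≡ false → isZero c ≡ true →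
                           rootTime (suc k) (left k a) ≢ rootTime (suc k) (right k c)
rootTime-left≢right-root k a c nz z
  rewrite rootTime-left-nonroot k a nz | rootTime-right k c | isZero⇒≡root k z | rootTime-root k =
  <⇒≢ (rootTime-pos k a nz) ∘ sym ∘ suc-injective

rootTime-oneCall : ∀ k x x' → isZero x ≡ false → isZero x' ≡ false →
                   treeParent k x ≡ treeParent k x' → rootTime k x ≡ rootTime k x' → x ≡ x'
rootTime-oneCall zero    zero _ () _ _ _
rootTime-oneCall (suc k) x x' nz nz' ep et with side k x | side k x'
... | onLeft a | onLeft a'
  rewrite treeParent-left k a | treeParent-left k a'
        | rootTime-left-nonroot k a (nonroot-left k nz) | rootTime-left-nonroot k a' (nonroot-left k nz') =
  cong (left k) (rootTime-oneCall k a a' (nonroot-left k nz) (nonroot-left k nz') (left-injective k ep) (suc-injective et))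
... | onLeft a | onRight c with isZero c in z
...   | true  = ⊥-elim (rootTime-left≢right-root k a c (nonroot-left k nz) z et)
...   | false rewrite treeParent-left k a | treeParent-right k c z = ⊥-elim (left≢right k ep)
rootTime-oneCall (suc k) x x' nz nz' ep et | onRight c | onLeft a with isZero c in z
...   | true  = ⊥-elim (rootTime-left≢right-root k a c (nonroot-left k nz') z (sym et))
...   | false rewrite treeParent-left k a | treeParent-right k c z = ⊥-elim (left≢right k (sym ep))
rootTime-oneCall (suc k) x x' nz nz' ep et | onRight c | onRight c' with isZero c in z | isZero c' in z'
... | true  | true  = cong (right k) (trans (isZero⇒≡root k z) (sym (isZero⇒≡root k z')))
... | true  | false rewrite treeParent-right-root k c z | treeParent-right k c' z' = ⊥-elim (left≢right k ep)
... | false | true  rewrite treeParent-right k c z | treeParent-right-root k c' z' = ⊥-elim (left≢right k (sym ep))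
... | false | false
  rewrite treeParent-right k c z | treeParent-right k c' z' | rootTime-right k c | rootTime-right k c' =
  cong (right k) (rootTime-oneCall k c c' z z' (right-injective k ep) (suc-injective et))

-- The schedule when u and an extra vertex adjacent to all of BT_k (the apex of B_k) start
-- informed: pairTime k u x is the round in which x is informed, byApex k u x says whether its
-- caller is the apex (otherwise it is treeParent k x).
pairTime : ∀ k → Fin (2 ^ k) → Fin (2 ^ k) → ℕ
pairTime zero    _ _ = 0
pairTime (suc k) u x = timeOn (halves k u) (halves k x)
  where
  timeOn : Fin (2 ^ k) ⊎ Fin (2 ^ k) → Fin (2 ^ k) ⊎ Fin (2 ^ k) → ℕ
  timeOn (inj₁ a) (inj₁ b) = suc (pairTime k a b)
  timeOn (inj₂ a) (inj₂ b) = suc (pairTime k a b)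
  timeOn _        (inj₁ c) = suc (rootTime k c)
  timeOn _        (inj₂ c) = suc (rootTime k c)

byApex : ∀ k → Fin (2 ^ k) → Fin (2 ^ k) → Bool
byApex zero    _ _ = false
byApex (suc k) u x = callerOn (halves k u) (halves k x)
  where
  callerOn : Fin (2 ^ k) ⊎ Fin (2 ^ k) → Fin (2 ^ k) ⊎ Fin (2 ^ k) → Bool
  callerOn (inj₁ a) (inj₁ b) = byApex k a b
  callerOn (inj₂ a) (inj₂ b) = byApex k a b
  callerOn _        (inj₁ c) = isZero c
  callerOn _        (inj₂ c) = isZero c

pairTime-left-left : ∀ k a b → pairTime (suc k) (left k a) (left k b) ≡ suc (pairTime k a b)
pairTime-left-left k a b rewrite halves-left k a | halves-left k b = refl

pairTime-right-right : ∀ k a b → pairTime (suc k) (right k a) (right k b) ≡ suc (pairTime k a b)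
pairTime-right-right k a b rewrite halves-right k a | halves-right k b = refl

pairTime-left-right : ∀ k a c → pairTime (suc k) (left k a) (right k c) ≡ suc (rootTime k c)
pairTime-left-right k a c rewrite halves-left k a | halves-right k c = refl

pairTime-right-left : ∀ k a c → pairTime (suc k) (right k a) (left k c) ≡ suc (rootTime k c)
pairTime-right-left k a c rewrite halves-right k a | halves-left k c = refl

byApex-left-left : ∀ k a b → byApex (suc k) (left k a) (left k b) ≡ byApex k a b
byApex-left-left k a b rewrite halves-left k a | halves-left k b = refl

byApex-right-right : ∀ k a b → byApex (suc k) (right k a) (right k b) ≡ byApex k a b
byApex-right-right k a b rewrite halves-right k a | halves-right k b = refl

byApex-left-right : ∀ k a c → byApex (suc k) (left k a) (right k c) ≡ isZero c
byApex-left-right k a c rewrite halves-left k a | halves-right k c = refl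

byApex-right-left : ∀ k a c → byApex (suc k) (right k a) (left k c) ≡ isZero c
byApex-right-left k a c rewrite halves-right k a | halves-left k c = refl

pairTime-≤ : ∀ k u x → pairTime k u x ≤ k
pairTime-≤ zero    u x = z≤n
pairTime-≤ (suc k) u x with side k u | side k x
... | onLeft a  | onLeft b  rewrite pairTime-left-left k a b   = s≤s (pairTime-≤ k a b)
... | onLeft a  | onRight c rewrite pairTime-left-right k a c  = s≤s (rootTime-≤ k c)
... | onRight a | onLeft c  rewrite pairTime-right-left k a c  = s≤s (rootTime-≤ k c)
... | onRight a | onRight b rewrite pairTime-right-right k a b = s≤s (pairTime-≤ k a b)

pairTime-pos : ∀ k u x → x ≢ u → 0 < pairTime k u x
pairTime-pos zero    zero zero x≢u = ⊥-elim (x≢u refl)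
pairTime-pos (suc k) u x _ with side k u | side k x
... | onLeft a  | onLeft b  rewrite pairTime-left-left k a b   = s≤s z≤n
... | onLeft a  | onRight c rewrite pairTime-left-right k a c  = s≤s z≤n
... | onRight a | onLeft c  rewrite pairTime-right-left k a c  = s≤s z≤n
... | onRight a | onRight b rewrite pairTime-right-right k a b = s≤s z≤n

byApex-false⇒nonroot : ∀ k u x → x ≢ u → byApex k u x ≡ false → isZero x ≡ false
byApex-false⇒nonroot zero    zero zero x≢u _ = ⊥-elim (x≢u refl)
byApex-false⇒nonroot (suc k) u x x≢u f with side k u | side k x
... | onLeft a  | onLeft b  rewrite byApex-left-left k a b | isZero-left k b =
  byApex-false⇒nonroot k a b (x≢u ∘ cong (left k)) f
... | onLeft a  | onRight c = isZero-right k c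
... | onRight a | onLeft c  rewrite byApex-right-left k a c | isZero-left k c = f
... | onRight a | onRight b = isZero-right k b

pairTime-treeParent-< : ∀ k u x → x ≢ u → byApex k u x ≡ false →
                        pairTime k u (treeParent k x) < pairTime k u x
pairTime-treeParent-< zero    zero zero x≢u _ = ⊥-elim (x≢u refl)
pairTime-treeParent-< (suc k) u x x≢u f with side k u | side k x
... | onLeft a | onLeft b
  rewrite byApex-left-left k a b | treeParent-left k b
        | pairTime-left-left k a (treeParent k b) | pairTime-left-left k a b =
  s≤s (pairTime-treeParent-< k a b (x≢u ∘ cong (left k)) f)
... | onLeft a | onRight c
  rewrite byApex-left-right k a c | treeParent-right k c f
        | pairTime-left-right k a (treeParent k c) | pairTime-left-right k a c =
  s≤s (rootTime-treeParent-< k c f)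
... | onRight a | onLeft c
  rewrite byApex-right-left k a c | treeParent-left k c
        | pairTime-right-left k a (treeParent k c) | pairTime-right-left k a c =
  s≤s (rootTime-treeParent-< k c f)
... | onRight a | onRight b
  rewrite byApex-right-right k a b | treeParent-right k b (byApex-false⇒nonroot k a b (x≢u ∘ cong (right k)) f)
        | pairTime-right-right k a (treeParent k b) | pairTime-right-right k a b =
  s≤s (pairTime-treeParent-< k a b (x≢u ∘ cong (right k)) f)

pairTime-oneCall-tree : ∀ k u x x' → x ≢ u → x' ≢ u → byApex k u x ≡ false → byApex k u x' ≡ false →
                        treeParent k x ≡ treeParent k x' → pairTime k u x ≡ pairTime k u x' → x ≡ x'
pairTime-oneCall-tree zero    zero zero _ x≢u _ _ _ _ _ = ⊥-elim (x≢u refl)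
pairTime-oneCall-tree (suc k) u x x' x≢u x'≢u f f' ep et with side k u | side k x | side k x'
... | onLeft a | onLeft b | onLeft b'
  rewrite byApex-left-left k a b | byApex-left-left k a b' | treeParent-left k b | treeParent-left k b'
        | pairTime-left-left k a b | pairTime-left-left k a b' =
  cong (left k) (pairTime-oneCall-tree k a b b' (x≢u ∘ cong (left k)) (x'≢u ∘ cong (left k)) f f'
    (left-injective k ep) (suc-injective et))
... | onLeft a | onLeft b | onRight c
  rewrite byApex-left-right k a c | treeParent-left k b | treeParent-right k c f' = ⊥-elim (left≢right k ep)
... | onLeft a | onRight c | onLeft b
  rewrite byApex-left-right k a c | treeParent-left k b | treeParent-right k c f = ⊥-elim (left≢right k (sym ep))
... | onLeft a | onRight c | onRight c'
  rewrite byApex-left-right k a c | byApex-left-right k a c' | treeParent-right k c f | treeParent-right k c' f'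
        | pairTime-left-right k a c | pairTime-left-right k a c' =
  cong (right k) (rootTime-oneCall k c c' f f' (right-injective k ep) (suc-injective et))
... | onRight a | onLeft c | onLeft c'
  rewrite byApex-right-left k a c | byApex-right-left k a c' | treeParent-left k c | treeParent-left k c'
        | pairTime-right-left k a c | pairTime-right-left k a c' =
  cong (left k) (rootTime-oneCall k c c' f f' (left-injective k ep) (suc-injective et))
... | onRight a | onLeft c | onRight b
  rewrite byApex-right-left k a c | byApex-right-right k a b | treeParent-left k c
        | treeParent-right k b (byApex-false⇒nonroot k a b (x'≢u ∘ cong (right k)) f') = ⊥-elim (left≢right k ep)
... | onRight a | onRight b | onLeft c
  rewrite byApex-right-left k a c | byApex-right-right k a b | treeParent-left k c
        | treeParent-right k b (byApex-false⇒nonroot k a b (x≢u ∘ cong (right k)) f) = ⊥-elim (left≢right k (sym ep))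
... | onRight a | onRight b | onRight b'
  rewrite byApex-right-right k a b | byApex-right-right k a b'
        | treeParent-right k b (byApex-false⇒nonroot k a b (x≢u ∘ cong (right k)) f)
        | treeParent-right k b' (byApex-false⇒nonroot k a b' (x'≢u ∘ cong (right k)) f')
        | pairTime-right-right k a b | pairTime-right-right k a b' =
  cong (right k) (pairTime-oneCall-tree k a b b' (x≢u ∘ cong (right k)) (x'≢u ∘ cong (right k)) f f'
    (right-injective k ep) (suc-injective et))

pairTime≢rootTime-root : ∀ k a b c → b ≢ a → isZero c ≡ true → pairTime k a b ≢ rootTime k c
pairTime≢rootTime-root k a b c b≢a z rewrite isZero⇒≡root k z | rootTime-root k =
  <⇒≢ (pairTime-pos k a b b≢a) ∘ sym

pairTime-oneCall-apex : ∀ k u x x' → x ≢ u → x' ≢ u → byApex k u x ≡ true → byApex k u x' ≡ true →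
                        pairTime k u x ≡ pairTime k u x' → x ≡ x'
pairTime-oneCall-apex zero    zero zero _ x≢u _ _ _ _ = ⊥-elim (x≢u refl)
pairTime-oneCall-apex (suc k) u x x' x≢u x'≢u t t' et with side k u | side k x | side k x'
... | onLeft a | onLeft b | onLeft b'
  rewrite byApex-left-left k a b | byApex-left-left k a b' | pairTime-left-left k a b | pairTime-left-left k a b' =
  cong (left k) (pairTime-oneCall-apex k a b b' (x≢u ∘ cong (left k)) (x'≢u ∘ cong (left k)) t t' (suc-injective et))
... | onLeft a | onLeft b | onRight c
  rewrite byApex-left-right k a c | pairTime-left-left k a b | pairTime-left-right k a c =
  ⊥-elim (pairTime≢rootTime-root k a b c (x≢u ∘ cong (left k)) t' (suc-injective et))
... | onLeft a | onRight c | onLeft b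
  rewrite byApex-left-right k a c | pairTime-left-left k a b | pairTime-left-right k a c =
  ⊥-elim (pairTime≢rootTime-root k a b c (x'≢u ∘ cong (left k)) t (sym (suc-injective et)))
... | onLeft a | onRight c | onRight c'
  rewrite byApex-left-right k a c | byApex-left-right k a c' =
  cong (right k) (trans (isZero⇒≡root k t) (sym (isZero⇒≡root k t')))
... | onRight a | onLeft c | onLeft c'
  rewrite byApex-right-left k a c | byApex-right-left k a c' =
  cong (left k) (trans (isZero⇒≡root k t) (sym (isZero⇒≡root k t')))
... | onRight a | onLeft c | onRight b
  rewrite byApex-right-left k a c | pairTime-right-right k a b | pairTime-right-left k a c =
  ⊥-elim (pairTime≢rootTime-root k a b c (x'≢u ∘ cong (right k)) t (sym (suc-injective et)))
... | onRight a | onRight b | onLeft c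
  rewrite byApex-right-left k a c | pairTime-right-right k a b | pairTime-right-left k a c =
  ⊥-elim (pairTime≢rootTime-root k a b c (x≢u ∘ cong (right k)) t' (suc-injective et))
... | onRight a | onRight b | onRight b'
  rewrite byApex-right-right k a b | byApex-right-right k a b' | pairTime-right-right k a b | pairTime-right-right k a b' =
  cong (right k) (pairTime-oneCall-apex k a b b' (x≢u ∘ cong (right k)) (x'≢u ∘ cong (right k)) t t'
    (suc-injective et))

-- A scheme in which v and w start informed: the conditions concern the other vertices only.
record PairScheme {n} (G : Graph n) (v w : Fin n) (T : ℕ) : Set where
  field
    time           : Fin n → ℕ
    time-bound     : ∀ u → time u ≤ T
    parent         : Fin n → Fin n
    parent-adj     : ∀ u → u ≢ v → u ≢ w → G (parent u) u ≡ true
    parent-earlier : ∀ u → u ≢ v → u ≢ w → time (parent u) < time u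
    one-call       : ∀ u u' → u ≢ v → u ≢ w → u' ≢ v → u' ≢ w →
                     parent u ≡ parent u' → time u ≡ time u' → u ≡ u'

PairScheme-swap : ∀ {n} {G : Graph n} {v w T} → PairScheme G v w T → PairScheme G w v T
PairScheme-swap S = record
  { time           = time
  ; time-bound     = time-bound
  ; parent         = parent
  ; parent-adj     = λ u u≢w u≢v → parent-adj u u≢v u≢w
  ; parent-earlier = λ u u≢w u≢v → parent-earlier u u≢v u≢w
  ; one-call       = λ u u' u≢w u≢v u'≢w u'≢v → one-call u u' u≢v u≢w u'≢v u'≢w
  }
  where open PairScheme S

-- v spends the first round calling w; afterwards the pair scheme runs one round late.
module _ {n} {G : Graph n} {v w : Fin n} {T : ℕ} (v≢w : v ≢ w) (vw-edge : G v w ≡ true)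
         (S : PairScheme G v w T) where
  open PairScheme S

  private
    time⁺ : Fin n → ℕ
    time⁺ u with u ≟ᶠ v | u ≟ᶠ w
    ... | yes _ | _     = 0
    ... | no _  | yes _ = 1
    ... | no _  | no _  = suc (time u)

    time⁺-v : time⁺ v ≡ 0
    time⁺-v with v ≟ᶠ v
    ... | yes _   = refl
    ... | no v≢v = ⊥-elim (v≢v refl)

    time⁺-w : time⁺ w ≡ 1
    time⁺-w with w ≟ᶠ v | w ≟ᶠ w
    ... | yes w≡v | _       = ⊥-elim (v≢w (sym w≡v))
    ... | no _    | yes _   = refl
    ... | no _    | no w≢w = ⊥-elim (w≢w refl)

    time⁺-other : ∀ u → u ≢ v → u ≢ w → time⁺ u ≡ suc (time u)
    time⁺-other u u≢v u≢w with u ≟ᶠ v | u ≟ᶠ w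
    ... | yes u≡v | _       = ⊥-elim (u≢v u≡v)
    ... | no _    | yes u≡w = ⊥-elim (u≢w u≡w)
    ... | no _    | no _    = refl

    time⁺-≤ : ∀ u → time⁺ u ≤ suc (time u)
    time⁺-≤ u with u ≟ᶠ v | u ≟ᶠ w
    ... | yes _ | _     = z≤n
    ... | no _  | yes _ = s≤s z≤n
    ... | no _  | no _  = ≤-refl

    parent⁺ : Fin n → Fin n
    parent⁺ u with u ≟ᶠ w
    ... | yes _ = v
    ... | no _  = parent u

    parent⁺-w : parent⁺ w ≡ v
    parent⁺-w with w ≟ᶠ w
    ... | yes _   = refl
    ... | no w≢w = ⊥-elim (w≢w refl)

    parent⁺-other : ∀ u → u ≢ w → parent⁺ u ≡ parent u
    parent⁺-other u u≢w with u ≟ᶠ w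
    ... | yes u≡w = ⊥-elim (u≢w u≡w)
    ... | no _    = refl

    time-pos : ∀ u → u ≢ v → u ≢ w → 0 < time u
    time-pos u u≢v u≢w = ≤-<-trans z≤n (parent-earlier u u≢v u≢w)

    parent⁺-adj : ∀ u → u ≢ v → G (parent⁺ u) u ≡ true
    parent⁺-adj u u≢v with toSum (u ≟ᶠ w)
    ... | inj₁ refl rewrite parent⁺-w = vw-edge
    ... | inj₂ u≢w  rewrite parent⁺-other u u≢w = parent-adj u u≢v u≢w

    parent⁺-earlier : ∀ u → u ≢ v → time⁺ (parent⁺ u) < time⁺ u
    parent⁺-earlier u u≢v with toSum (u ≟ᶠ w)
    ... | inj₁ refl rewrite parent⁺-w | time⁺-v | time⁺-w = s≤s z≤n
    ... | inj₂ u≢w  rewrite parent⁺-other u u≢w | time⁺-other u u≢v u≢w =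
      ≤-<-trans (time⁺-≤ (parent u)) (s≤s (parent-earlier u u≢v u≢w))

    w-calls-alone : ∀ u → u ≢ v → u ≢ w → time⁺ w ≢ time⁺ u
    w-calls-alone u u≢v u≢w rewrite time⁺-w | time⁺-other u u≢v u≢w =
      <⇒≢ (time-pos u u≢v u≢w) ∘ suc-injective

    one-call⁺ : ∀ u u' → u ≢ v → u' ≢ v → parent⁺ u ≡ parent⁺ u' → time⁺ u ≡ time⁺ u' → u ≡ u'
    one-call⁺ u u' u≢v u'≢v ep et with toSum (u ≟ᶠ w) | toSum (u' ≟ᶠ w)
    ... | inj₁ refl | inj₁ refl = refl
    ... | inj₁ refl | inj₂ u'≢w = ⊥-elim (w-calls-alone u' u'≢v u'≢w et)
    ... | inj₂ u≢w  | inj₁ refl = ⊥-elim (w-calls-alone u u≢v u≢w (sym et))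
    ... | inj₂ u≢w  | inj₂ u'≢w
      rewrite parent⁺-other u u≢w | parent⁺-other u' u'≢w
            | time⁺-other u u≢v u≢w | time⁺-other u' u'≢v u'≢w =
      one-call u u' u≢v u≢w u'≢v u'≢w ep (suc-injective et)

  PairScheme⇒Scheme : Scheme G v (suc T)
  PairScheme⇒Scheme = record
    { time           = time⁺
    ; time-orig      = time⁺-v
    ; time-bound     = λ u → ≤-trans (time⁺-≤ u) (s≤s (time-bound u))
    ; parent         = parent⁺
    ; parent-adj     = parent⁺-adj
    ; parent-earlier = parent⁺-earlier
    ; one-call       = one-call⁺
    }

-- The graph B_k

tree : ∀ k → Fin (2 ^ k) → Fin (2 ^ k + 1)
tree k a = a ↑ˡ 1

apex : ∀ k → Fin (2 ^ k + 1)
apex k = 2 ^ k ↑ʳ zero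

splitAt-tree : ∀ k a → splitAt (2 ^ k) {1} (tree k a) ≡ inj₁ a
splitAt-tree k a = splitAt-↑ˡ (2 ^ k) a 1

splitAt-apex : ∀ k → splitAt (2 ^ k) {1} (apex k) ≡ inj₂ zero
splitAt-apex k = splitAt-↑ʳ (2 ^ k) 1 zero

data BVertex (k : ℕ) : Fin (2 ^ k + 1) → Set where
  isTree : ∀ a → BVertex k (tree k a)
  isApex : BVertex k (apex k)

bvertex : ∀ k x → BVertex k x
bvertex k x with splitAt (2 ^ k) {1} x in eq
... | inj₁ a    = subst (BVertex k) (splitAt⁻¹-↑ˡ eq) (isTree a)
... | inj₂ zero = subst (BVertex k) (splitAt⁻¹-↑ʳ eq) isApex

tree-injective : ∀ k {a b} → tree k a ≡ tree k b → a ≡ b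
tree-injective k = ↑ˡ-injective 1 _ _

tree≢apex : ∀ k {a} → tree k a ≢ apex k
tree≢apex k {a} e with trans (sym (splitAt-tree k a)) (trans (cong (splitAt (2 ^ k)) e) (splitAt-apex k))
... | ()

B-tree-tree : ∀ k a b → B k (tree k a) (tree k b) ≡ BT k a b
B-tree-tree k a b rewrite splitAt-tree k a | splitAt-tree k b = refl

B-tree-apex : ∀ k a → B k (tree k a) (apex k) ≡ true
B-tree-apex k a rewrite splitAt-tree k a | splitAt-apex k = refl

B-apex-tree : ∀ k a → B k (apex k) (tree k a) ≡ true
B-apex-tree k a rewrite splitAt-tree k a | splitAt-apex k = refl

B-apex-apex : ∀ k → B k (apex k) (apex k) ≡ false
B-apex-apex k rewrite splitAt-apex k = refl

B-connected : ∀ k → Connected (B k)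
B-connected k x y with bvertex k x | bvertex k y
... | isTree a | isTree b = step (step here (B-tree-apex k a)) (B-apex-tree k b)
... | isTree a | isApex   = step here (B-tree-apex k a)
... | isApex   | isTree b = step here (B-apex-tree k b)
... | isApex   | isApex   = here

pairSchemeB : ∀ k u → PairScheme (B k) (tree k u) (apex k) k
pairSchemeB k u = record
  { time           = time
  ; time-bound     = time-bound
  ; parent         = parent
  ; parent-adj     = parent-adj
  ; parent-earlier = parent-earlier
  ; one-call       = one-call
  }
  where
  time : Fin (2 ^ k + 1) → ℕ
  time x = [ pairTime k u , (λ _ → 0) ]′ (splitAt (2 ^ k) x)

  caller : Fin (2 ^ k) → Fin (2 ^ k + 1)
  caller a = if byApex k u a then apex k else tree k (treeParent k a)

  parent : Fin (2 ^ k + 1) → Fin (2 ^ k + 1)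
  parent x = [ caller , (λ _ → apex k) ]′ (splitAt (2 ^ k) x)

  time-tree : ∀ a → time (tree k a) ≡ pairTime k u a
  time-tree a rewrite splitAt-tree k a = refl

  time-apex : time (apex k) ≡ 0
  time-apex rewrite splitAt-apex k = refl

  parent-tree : ∀ a → parent (tree k a) ≡ caller a
  parent-tree a rewrite splitAt-tree k a = refl

  time-bound : ∀ x → time x ≤ k
  time-bound x with bvertex k x
  ... | isTree a rewrite time-tree a = pairTime-≤ k u a
  ... | isApex   rewrite time-apex   = z≤n

  parent-adj : ∀ x → x ≢ tree k u → x ≢ apex k → B k (parent x) x ≡ true
  parent-adj x x≢u x≢apex with bvertex k x
  ... | isApex = ⊥-elim (x≢apex refl)
  ... | isTree a rewrite parent-tree a with byApex k u a in f
  ...   | true  = B-apex-tree k a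
  ...   | false rewrite B-tree-tree k (treeParent k a) a =
    BT-treeParent k a (byApex-false⇒nonroot k u a (x≢u ∘ cong (tree k)) f)

  parent-earlier : ∀ x → x ≢ tree k u → x ≢ apex k → time (parent x) < time x
  parent-earlier x x≢u x≢apex with bvertex k x
  ... | isApex = ⊥-elim (x≢apex refl)
  ... | isTree a rewrite parent-tree a | time-tree a with byApex k u a in f
  ...   | true  rewrite time-apex = pairTime-pos k u a (x≢u ∘ cong (tree k))
  ...   | false rewrite time-tree (treeParent k a) = pairTime-treeParent-< k u a (x≢u ∘ cong (tree k)) f

  one-call : ∀ x x' → x ≢ tree k u → x ≢ apex k → x' ≢ tree k u → x' ≢ apex k →
             parent x ≡ parent x' → time x ≡ time x' → x ≡ x'
  one-call x x' x≢u x≢apex x'≢u x'≢apex ep et with bvertex k x | bvertex k x'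
  ... | isApex   | _         = ⊥-elim (x≢apex refl)
  ... | isTree _ | isApex    = ⊥-elim (x'≢apex refl)
  ... | isTree a | isTree a'
    rewrite parent-tree a | parent-tree a' | time-tree a | time-tree a'
    with byApex k u a in f | byApex k u a' in f'
  ...   | true  | true  =
    cong (tree k) (pairTime-oneCall-apex k u a a' (x≢u ∘ cong (tree k)) (x'≢u ∘ cong (tree k)) f f' et)
  ...   | true  | false = ⊥-elim (tree≢apex k (sym ep))
  ...   | false | true  = ⊥-elim (tree≢apex k ep)
  ...   | false | false =
    cong (tree k) (pairTime-oneCall-tree k u a a' (x≢u ∘ cong (tree k)) (x'≢u ∘ cong (tree k)) f f'
                    (tree-injective k ep) et)

schemeB : ∀ k v → Scheme (B k) v (suc k)
schemeB k v with bvertex k v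
... | isTree u = PairScheme⇒Scheme (tree≢apex k) (B-tree-apex k u) (pairSchemeB k u)
... | isApex   = PairScheme⇒Scheme (tree≢apex k ∘ sym) (B-apex-tree k (root k)) (PairScheme-swap (pairSchemeB k (root k)))

2^pred+2^pred : ∀ t → 0 < t → 2 ^ (t ∸ 1) + 2 ^ (t ∸ 1) ≡ 2 ^ t
2^pred+2^pred (suc t) _ = cong (2 ^ t +_) (sym (+-identityʳ (2 ^ t)))

-- A vertex informed in round t gets a code in [2 ^ (t ∸ 1), 2 ^ t) from which its
-- caller's code, and hence (by one-call) the vertex itself, can be read off.
module _ {n} {G : Graph n} {v : Fin n} {T : ℕ} (S : Scheme G v T) where
  open Scheme S

  private
    code : ℕ → Fin n → ℕ
    code zero    _ = 0
    code (suc f) u with u ≟ᶠ v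
    ... | yes _ = 0
    ... | no  _ = code f (parent u) + 2 ^ (time u ∸ 1)

    code-v : ∀ f → code (suc f) v ≡ 0
    code-v f with v ≟ᶠ v
    ... | yes _   = refl
    ... | no v≢v = ⊥-elim (v≢v refl)

    code-other : ∀ f u → u ≢ v → code (suc f) u ≡ code f (parent u) + 2 ^ (time u ∸ 1)
    code-other f u u≢v with u ≟ᶠ v
    ... | yes u≡v = ⊥-elim (u≢v u≡v)
    ... | no  _   = refl

    time-pos : ∀ u → u ≢ v → 0 < time u
    time-pos u u≢v = ≤-<-trans z≤n (parent-earlier u u≢v)

    code-< : ∀ f u → time u < f → code f u < 2 ^ time u
    code-< (suc f) u t<f with u ≟ᶠ v
    ... | yes _   = m^n>0 2 (time u)
    ... | no  u≢v = begin-strict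
      code f (parent u) + 2 ^ (time u ∸ 1) <⟨ +-monoˡ-< _ (<-≤-trans (code-< f (parent u) tp<f) (^-monoʳ-≤ 2 tp≤)) ⟩
      2 ^ (time u ∸ 1) + 2 ^ (time u ∸ 1)  ≡⟨ 2^pred+2^pred (time u) (time-pos u u≢v) ⟩
      2 ^ time u                           ∎
      where
      open ≤-Reasoning
      tp<f : time (parent u) < f
      tp<f = <-≤-trans (parent-earlier u u≢v) (s≤s⁻¹ t<f)
      tp≤ : time (parent u) ≤ time u ∸ 1
      tp≤ = <⇒≤pred (parent-earlier u u≢v)

    code-≥ : ∀ f u → u ≢ v → 2 ^ (time u ∸ 1) ≤ code (suc f) u
    code-≥ f u u≢v rewrite code-other f u u≢v = m≤n+m _ _

    code-pos : ∀ f u → u ≢ v → 0 < code (suc f) u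
    code-pos f u u≢v = <-≤-trans (m^n>0 2 (time u ∸ 1)) (code-≥ f u u≢v)

    code-time-< : ∀ f u u' → u' ≢ v → time u < suc f → time u < time u' → code (suc f) u < code (suc f) u'
    code-time-< f u u' u'≢v tu<f tu<tu' =
      <-≤-trans (code-< (suc f) u tu<f) (≤-trans (^-monoʳ-≤ 2 (<⇒≤pred tu<tu')) (code-≥ f u' u'≢v))

    code-injective : ∀ f u u' → time u < f → time u' < f → code f u ≡ code f u' → u ≡ u'
    code-injective (suc f) u u' tu<f tu'<f e with toSum (u ≟ᶠ v) | toSum (u' ≟ᶠ v)
    ... | inj₁ refl | inj₁ refl = refl
    ... | inj₁ refl | inj₂ u'≢v = ⊥-elim (<⇒≢ (code-pos f u' u'≢v) (trans (sym (code-v f)) e))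
    ... | inj₂ u≢v  | inj₁ refl = ⊥-elim (<⇒≢ (code-pos f u u≢v) (trans (sym (code-v f)) (sym e)))
    ... | inj₂ u≢v  | inj₂ u'≢v = one-call u u' u≢v u'≢v (code-injective f (parent u) (parent u')
        (<-≤-trans (parent-earlier u u≢v) (s≤s⁻¹ tu<f)) (<-≤-trans (parent-earlier u' u'≢v) (s≤s⁻¹ tu'<f))
        same-caller-code)
        same-time
      where
      same-time : time u ≡ time u'
      same-time with <-cmp (time u) (time u')
      ... | tri< lt _ _ = ⊥-elim (<⇒≢ (code-time-< f u u' u'≢v tu<f lt) e)
      ... | tri≈ _ eq _ = eq
      ... | tri> _ _ gt = ⊥-elim (<⇒≢ (code-time-< f u' u u≢v tu'<f gt) (sym e))

      same-caller-code : code f (parent u) ≡ code f (parent u')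
      same-caller-code = +-cancelʳ-≡ (2 ^ (time u ∸ 1)) _ _ (begin
        code f (parent u) + 2 ^ (time u ∸ 1)   ≡⟨ sym (code-other f u u≢v) ⟩
        code (suc f) u                         ≡⟨ e ⟩
        code (suc f) u'                        ≡⟨ code-other f u' u'≢v ⟩
        code f (parent u') + 2 ^ (time u' ∸ 1) ≡⟨ cong (λ t → code f (parent u') + 2 ^ (t ∸ 1)) (sym same-time) ⟩
        code f (parent u') + 2 ^ (time u ∸ 1)  ∎)
        where open ≡-Reasoning

  Scheme⇒≤2^ : n ≤ 2 ^ T
  Scheme⇒≤2^ = injective⇒≤ {f = codeFin} λ {u} {u'} e →
    code-injective (suc T) u u' (s≤s (time-bound u)) (s≤s (time-bound u'))
      (subst₂ _≡_ (toℕ-fromℕ< _) (toℕ-fromℕ< _) (cong toℕ e))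
    where
    codeFin : Fin n → Fin (2 ^ T)
    codeFin u = fromℕ< (<-≤-trans (code-< (suc T) u (s≤s (time-bound u))) (^-monoʳ-≤ 2 (time-bound u)))

⌈2^[1+k]+1/2⌉≡2^k+1 : ∀ k → ⌈ 2 ^ suc k + 1 /2⌉ ≡ 2 ^ k + 1
⌈2^[1+k]+1/2⌉≡2^k+1 k = go (2 ^ k)
  where
  go : ∀ m → ⌈ m + (m + 0) + 1 /2⌉ ≡ m + 1
  go zero    = refl
  go (suc m) rewrite +-suc m (m + 0) = cong suc (go m)

⌈log₂[2^k+1]⌉≡1+k : ∀ k → ⌈log₂ (2 ^ k + 1) ⌉ ≡ suc k
⌈log₂[2^k+1]⌉≡1+k zero    = refl
⌈log₂[2^k+1]⌉≡1+k (suc k) = pred≡⇒≡suc (begin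
  ⌈log₂ (2 ^ suc k + 1) ⌉ ∸ 1        ≡⟨ sym (⌈log₂⌈n/2⌉⌉≡⌈log₂n⌉∸1 (2 ^ suc k + 1)) ⟩
  ⌈log₂ ⌈ 2 ^ suc k + 1 /2⌉ ⌉        ≡⟨ cong ⌈log₂_⌉ (⌈2^[1+k]+1/2⌉≡2^k+1 k) ⟩
  ⌈log₂ (2 ^ k + 1) ⌉                ≡⟨ ⌈log₂[2^k+1]⌉≡1+k k ⟩
  suc k                              ∎)
  where
  open ≡-Reasoning
  pred≡⇒≡suc : ∀ {m j} → m ∸ 1 ≡ suc j → m ≡ suc (suc j)
  pred≡⇒≡suc {suc m} = cong suc

B-broadcastTime : ∀ k v → BroadcastTime (B k) v (suc k)
B-broadcastTime k v = schemeB k v , no-faster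
  where
  no-faster : ∀ T → T < suc k → ¬ Scheme (B k) v T
  no-faster T T<1+k S = <⇒≱ (m<m+n (2 ^ k) (s≤s z≤n))
    (≤-trans (Scheme⇒≤2^ S) (^-monoʳ-≤ 2 (s≤s⁻¹ T<1+k)))

B-isBroadcastGraph : ∀ k → IsBroadcastGraph (B k)
B-isBroadcastGraph k = B-connected k , subst (BroadcastNumber (B k)) (sym (⌈log₂[2^k+1]⌉≡1+k k))
  ((λ v → suc k , ≤-refl , B-broadcastTime k v) , apex k , B-broadcastTime k (apex k))

-- Series-parallel multigraphs

indicator : Bool → ℕ
indicator b = if b then 1 else 0

eqF-refl : ∀ {m} (a : Fin m) → eqF a a ≡ true
eqF-refl a with a ≟ᶠ a
... | yes _   = refl
... | no a≢a = ⊥-elim (a≢a refl)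

eqF-≢ : ∀ {m} {a b : Fin m} → a ≢ b → eqF a b ≡ false
eqF-≢ {a = a} {b} a≢b with a ≟ᶠ b
... | yes a≡b = ⊥-elim (a≢b a≡b)
... | no _    = refl

eqF⇒≡ : ∀ {m} {a b : Fin m} → eqF a b ≡ true → a ≡ b
eqF⇒≡ {a = a} {b} e with a ≟ᶠ b
... | yes a≡b = a≡b

eqF-inject₁ : ∀ {m} (x a : Fin m) → eqF (inject₁ x) (inject₁ a) ≡ eqF x a
eqF-inject₁ x a with x ≟ᶠ a
... | yes refl = eqF-refl (inject₁ x)
... | no x≢a   = eqF-≢ (x≢a ∘ inject₁-injective)

eqF-inject₁-fromℕ : ∀ {m} (x : Fin m) → eqF (inject₁ x) (fromℕ m) ≡ false
eqF-inject₁-fromℕ x = eqF-≢ (fromℕ≢inject₁ ∘ sym)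

eqF-fromℕ-inject₁ : ∀ {m} (x : Fin m) → eqF (fromℕ m) (inject₁ x) ≡ false
eqF-fromℕ-inject₁ x = eqF-≢ fromℕ≢inject₁

-- mult (e ∷ es) a b reduces to mult₁ e a b + mult es a b.
mult₁ : ∀ {m} → Edge m → Fin m → Fin m → ℕ
mult₁ (x , y) a b = if eqF x a ∧ eqF y b then 1 else (if eqF x b ∧ eqF y a then 1 else 0)

mult-++ : ∀ {m} (es es' : List (Edge m)) a b → mult (es ++ es') a b ≡ mult es a b + mult es' a b
mult-++ []       es' a b = refl
mult-++ (e ∷ es) es' a b = trans (cong (mult₁ e a b +_) (mult-++ es es' a b)) (sym (+-assoc (mult₁ e a b) _ _))

mult₁-pos : ∀ {m} x y (a b : Fin m) → 0 < mult₁ (x , y) a b → (x ≡ a × y ≡ b) ⊎ (x ≡ b × y ≡ a)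
mult₁-pos x y a b pos with eqF x a in xa | eqF y b in yb | eqF x b in xb | eqF y a in ya
... | true  | true  | _     | _     = inj₁ (eqF⇒≡ xa , eqF⇒≡ yb)
... | true  | false | true  | true  = inj₂ (eqF⇒≡ xb , eqF⇒≡ ya)
... | false | _     | true  | true  = inj₂ (eqF⇒≡ xb , eqF⇒≡ ya)

mult-pos⇒split : ∀ {m} (es : List (Edge m)) a b → 0 < mult es a b →
  Σ (List (Edge m)) λ es₁ → Σ (List (Edge m)) λ es₂ → Σ (Fin m) λ x → Σ (Fin m) λ y →
    es ≡ es₁ ++ (x , y) ∷ es₂ × ((x ≡ a × y ≡ b) ⊎ (x ≡ b × y ≡ a))
mult-pos⇒split ((x , y) ∷ es) a b pos with mult₁ (x , y) a b in e
... | suc _ = [] , es , x , y , refl , mult₁-pos x y a b (subst (0 <_) (sym e) (s≤s z≤n))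
... | zero with mult-pos⇒split es a b pos
...   | es₁ , es₂ , x' , y' , eq , ends = (x , y) ∷ es₁ , es₂ , x' , y' , cong ((x , y) ∷_) eq , ends

mult₁-lift : ∀ {m} (e : Edge m) a b → mult₁ (liftE e) (inject₁ a) (inject₁ b) ≡ mult₁ e a b
mult₁-lift (x , y) a b rewrite eqF-inject₁ x a | eqF-inject₁ y b | eqF-inject₁ x b | eqF-inject₁ y a = refl

mult₁-lift-fromℕˡ : ∀ {m} (e : Edge m) b → mult₁ (liftE e) (fromℕ m) b ≡ 0
mult₁-lift-fromℕˡ (x , y) b rewrite eqF-inject₁-fromℕ x | eqF-inject₁-fromℕ y with eqF (inject₁ x) b
... | true  = refl
... | false = refl

mult₁-lift-fromℕʳ : ∀ {m} (e : Edge m) a → mult₁ (liftE e) a (fromℕ m) ≡ 0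
mult₁-lift-fromℕʳ (x , y) a rewrite eqF-inject₁-fromℕ x | eqF-inject₁-fromℕ y with eqF (inject₁ x) a
... | true  = refl
... | false = refl

mult-lift : ∀ {m} (es : List (Edge m)) a b → mult (map liftE es) (inject₁ a) (inject₁ b) ≡ mult es a b
mult-lift []       a b = refl
mult-lift (e ∷ es) a b = cong₂ _+_ (mult₁-lift e a b) (mult-lift es a b)

mult-lift-fromℕˡ : ∀ {m} (es : List (Edge m)) b → mult (map liftE es) (fromℕ m) b ≡ 0
mult-lift-fromℕˡ []       b = refl
mult-lift-fromℕˡ (e ∷ es) b = cong₂ _+_ (mult₁-lift-fromℕˡ e b) (mult-lift-fromℕˡ es b)

mult-lift-fromℕʳ : ∀ {m} (es : List (Edge m)) a → mult (map liftE es) a (fromℕ m) ≡ 0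
mult-lift-fromℕʳ []       a = refl
mult-lift-fromℕʳ (e ∷ es) a = cong₂ _+_ (mult₁-lift-fromℕʳ e a) (mult-lift-fromℕʳ es a)

-- Subdividing a doubled copy of the edge (x, y): the new vertex fromℕ m is joined to x and to y.
attach : ∀ {m} → List (Edge m) → Edge m → List (Edge m) → List (Edge (suc m))
attach {m} es₁ (x , y) es₂ =
  map liftE es₁ ++ (inject₁ x , fromℕ m) ∷ (fromℕ m , inject₁ y) ∷ map liftE ((x , y) ∷ es₂)

SP-attach : ∀ {m} es₁ e es₂ → SP m (es₁ ++ e ∷ es₂) → SP (suc m) (attach es₁ e es₂)
SP-attach es₁ (x , y) es₂ sp = series es₁ ((x , y) ∷ es₂) x y (parallel es₁ es₂ (x , y) sp)

endpoints : ∀ {m} → Edge m → Fin m → ℕ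
endpoints (x , y) b = indicator (eqF x b) + indicator (eqF y b)

mult-attach : ∀ {m} es₁ x y es₂ (a b : Fin (suc m)) →
  mult (attach es₁ (x , y) es₂) a b ≡
  mult (map liftE (es₁ ++ (x , y) ∷ es₂)) a b
    + (mult₁ (inject₁ x , fromℕ m) a b + mult₁ (fromℕ m , inject₁ y) a b)
mult-attach {m} es₁ x y es₂ a b = begin
  mult (attach es₁ (x , y) es₂) a b
    ≡⟨ mult-++ (map liftE es₁) _ a b ⟩
  L₁ + (new₁ + (new₂ + L₂))
    ≡⟨ solve 4 (λ A s₁ s₂ C → A :+ (s₁ :+ (s₂ :+ C)) := (A :+ C) :+ (s₁ :+ s₂)) refl L₁ new₁ new₂ L₂ ⟩
  (L₁ + L₂) + (new₁ + new₂)
    ≡⟨ cong (_+ (new₁ + new₂)) (sym (trans (cong (λ es → mult es a b) (map-++ liftE es₁ ((x , y) ∷ es₂)))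
                                           (mult-++ (map liftE es₁) _ a b))) ⟩
  mult (map liftE (es₁ ++ (x , y) ∷ es₂)) a b + (new₁ + new₂) ∎
  where
  open ≡-Reasoning
  open +-*-Solver
  L₁ = mult (map liftE es₁) a b
  L₂ = mult (map liftE ((x , y) ∷ es₂)) a b
  new₁ = mult₁ (inject₁ x , fromℕ m) a b
  new₂ = mult₁ (fromℕ m , inject₁ y) a b

mult-attach-old : ∀ {m} es₁ e es₂ (a b : Fin m) →
                  mult (attach es₁ e es₂) (inject₁ a) (inject₁ b) ≡ mult (es₁ ++ e ∷ es₂) a b
mult-attach-old {m} es₁ (x , y) es₂ a b
  rewrite mult-attach es₁ x y es₂ (inject₁ a) (inject₁ b) | mult-lift (es₁ ++ (x , y) ∷ es₂) a b
        | eqF-fromℕ-inject₁ a | eqF-fromℕ-inject₁ b | ∧-zeroʳ (eqF (inject₁ x) (inject₁ a))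
        | ∧-zeroʳ (eqF (inject₁ x) (inject₁ b)) = +-identityʳ _

mult-attach-newˡ : ∀ {m} es₁ e es₂ (b : Fin m) → mult (attach es₁ e es₂) (fromℕ m) (inject₁ b) ≡ endpoints e b
mult-attach-newˡ {m} es₁ (x , y) es₂ b
  rewrite mult-attach es₁ x y es₂ (fromℕ m) (inject₁ b) | mult-lift-fromℕˡ (es₁ ++ (x , y) ∷ es₂) (inject₁ b)
        | eqF-inject₁-fromℕ x | eqF-inject₁ x b | eqF-refl (fromℕ m) | ∧-identityʳ (eqF x b)
        | eqF-inject₁ y b | eqF-fromℕ-inject₁ b = refl

mult-attach-newʳ : ∀ {m} es₁ e es₂ (a : Fin m) → mult (attach es₁ e es₂) (inject₁ a) (fromℕ m) ≡ endpoints e a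
mult-attach-newʳ {m} es₁ (x , y) es₂ a
  rewrite mult-attach es₁ x y es₂ (inject₁ a) (fromℕ m) | mult-lift-fromℕʳ (es₁ ++ (x , y) ∷ es₂) (inject₁ a)
        | eqF-inject₁ x a | eqF-refl (fromℕ m) | ∧-identityʳ (eqF x a) | eqF-inject₁-fromℕ x
        | eqF-fromℕ-inject₁ a | eqF-inject₁ y a with eqF x a
... | true  = refl
... | false = refl

mult-attach-new : ∀ {m} es₁ e es₂ → mult (attach es₁ e es₂) (fromℕ m) (fromℕ m) ≡ 0
mult-attach-new {m} es₁ (x , y) es₂
  rewrite mult-attach es₁ x y es₂ (fromℕ m) (fromℕ m) | mult-lift-fromℕˡ (es₁ ++ (x , y) ∷ es₂) (fromℕ m)
        | eqF-inject₁-fromℕ x | eqF-refl (fromℕ m) | eqF-inject₁-fromℕ y = refl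

Realizes : ∀ {m} → List (Edge m) → (ℕ → ℕ → ℕ) → Set
Realizes {m} es h = ∀ (a b : Fin m) → mult es a b ≡ h (toℕ a) (toℕ b)

record JoinedToApexAnd (h : ℕ → ℕ → ℕ) (m p : ℕ) : Set where
  field
    apex-edge : h m 0 ≡ 1 × h 0 m ≡ 1
    p-edge    : h m p ≡ 1 × h p m ≡ 1
    no-other  : ∀ j → j ≤ m → j ≢ 0 → j ≢ p → h m j ≡ 0 × h j m ≡ 0

endpoints-swap : ∀ {m} (x y b : Fin m) → endpoints (x , y) b ≡ endpoints (y , x) b
endpoints-swap x y b = +-comm (indicator (eqF x b)) (indicator (eqF y b))

endpoints-apex-edge : ∀ {h M p} → JoinedToApexAnd h (suc M) p → (q : Fin (suc M)) → toℕ q ≡ p → q ≢ zero →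
                      ∀ b → endpoints (q , zero) b ≡ h (suc M) (toℕ b) × endpoints (q , zero) b ≡ h (toℕ b) (suc M)
endpoints-apex-edge {h} {M} {p} J q refl q≢0 b with b ≟ᶠ zero | b ≟ᶠ q
... | yes refl | _ rewrite eqF-≢ q≢0 = sym (proj₁ apex-edge) , sym (proj₂ apex-edge)
  where open JoinedToApexAnd J
... | no b≢0 | yes refl rewrite eqF-refl q | eqF-≢ (b≢0 ∘ sym) = sym (proj₁ p-edge) , sym (proj₂ p-edge)
  where open JoinedToApexAnd J
... | no b≢0 | no b≢q rewrite eqF-≢ (b≢q ∘ sym) | eqF-≢ (b≢0 ∘ sym) =
  sym (proj₁ none) , sym (proj₂ none)
  where
  open JoinedToApexAnd J
  none = no-other (toℕ b) (<⇒≤ (toℕ<n b)) (b≢0 ∘ toℕ-injective) (b≢q ∘ toℕ-injective)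

-- h describes an apex 0 joined to every later vertex, together with a tree on 1, …, n − 1
-- in which each vertex m ≥ 2 hangs from an earlier vertex p.
module ApexTree (n : ℕ) (h : ℕ → ℕ → ℕ)
  (h00 : h 0 0 ≡ 0) (h01 : h 0 1 ≡ 1) (h10 : h 1 0 ≡ 1) (h11 : h 1 1 ≡ 0)
  (joined : ∀ m → 2 ≤ m → m < n → Σ ℕ λ p → 1 ≤ p × p < m × JoinedToApexAnd h m p) where

  h-to-apex : ∀ p → 1 ≤ p → p < n → h p 0 ≡ 1
  h-to-apex 1             _ _   = h10
  h-to-apex (suc (suc q)) _ p<n with joined (2 + q) (s≤s (s≤s z≤n)) p<n
  ... | _ , _ , _ , J = proj₁ (JoinedToApexAnd.apex-edge J)

  private
    endpoints-new : ∀ {M p} → JoinedToApexAnd h (suc M) p → (q : Fin (suc M)) → toℕ q ≡ p → 1 ≤ p →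
                    ∀ {x y} → (x ≡ q × y ≡ zero) ⊎ (x ≡ zero × y ≡ q) →
                    ∀ b → endpoints (x , y) b ≡ h (suc M) (toℕ b) × endpoints (x , y) b ≡ h (toℕ b) (suc M)
    endpoints-new {M} J q q≡p 1≤p {x} {y} ends b = by-orientation ends
      where
      q≢0 : q ≢ zero
      q≢0 q≡0 = <⇒≢ 1≤p (sym (trans (sym q≡p) (cong toℕ q≡0)))
      by-orientation : (x ≡ q × y ≡ zero) ⊎ (x ≡ zero × y ≡ q) →
                       endpoints (x , y) b ≡ h (suc M) (toℕ b) × endpoints (x , y) b ≡ h (toℕ b) (suc M)
      by-orientation (inj₁ (refl , refl)) = endpoints-apex-edge J q q≡p q≢0 b
      by-orientation (inj₂ (refl , refl)) rewrite endpoints-swap zero q b = endpoints-apex-edge J q q≡p q≢0 b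

    SP-step : ∀ d → 3 + d ≤ n → Σ (List (Edge (2 + d))) (λ es → SP (2 + d) es × Realizes es h) →
              Σ (List (Edge (3 + d))) λ es → SP (3 + d) es × Realizes es h
    SP-step d M<n (es , sp , realizes) with joined (2 + d) (s≤s (s≤s z≤n)) M<n
    ... | p , 1≤p , p<M , J with mult-pos⇒split es (fromℕ< p<M) zero (subst (0 <_) (sym edge) (s≤s z≤n))
      where
      edge : mult es (fromℕ< p<M) zero ≡ 1
      edge = trans (realizes _ zero) (trans (cong (λ i → h i 0) (toℕ-fromℕ< p<M)) (h-to-apex p 1≤p (<-trans p<M M<n)))
    ... | es₁ , es₂ , x , y , refl , ends = attach es₁ (x , y) es₂ , SP-attach es₁ (x , y) es₂ sp , realizes′
      where
      new = endpoints-new J (fromℕ< p<M) (toℕ-fromℕ< p<M) 1≤p ends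
      realizes′ : Realizes (attach es₁ (x , y) es₂) h
      realizes′ a b with view a | view b
      ... | ‵inject₁ a′ | ‵inject₁ b′
        rewrite mult-attach-old es₁ (x , y) es₂ a′ b′ | toℕ-inject₁ a′ | toℕ-inject₁ b′ = realizes a′ b′
      ... | ‵fromℕ | ‵inject₁ b′
        rewrite mult-attach-newˡ es₁ (x , y) es₂ b′ | toℕ-fromℕ (2 + d) | toℕ-inject₁ b′ = proj₁ (new b′)
      ... | ‵inject₁ a′ | ‵fromℕ
        rewrite mult-attach-newʳ es₁ (x , y) es₂ a′ | toℕ-fromℕ (2 + d) | toℕ-inject₁ a′ = proj₂ (new a′)
      ... | ‵fromℕ | ‵fromℕ
        rewrite mult-attach-new es₁ (x , y) es₂ | toℕ-fromℕ (2 + d) =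
        sym (proj₁ (JoinedToApexAnd.no-other J (2 + d) ≤-refl (λ ()) (<⇒≢ p<M ∘ sym)))

  SP-prefix : ∀ d → 2 + d ≤ n → Σ (List (Edge (2 + d))) λ es → SP (2 + d) es × Realizes es h
  SP-prefix zero _ = (zero , suc zero) ∷ [] , k2 , realizes
    where
    realizes : Realizes ((zero , suc zero) ∷ []) h
    realizes zero       zero       = sym h00
    realizes zero       (suc zero) = sym h01
    realizes (suc zero) zero       = sym h10
    realizes (suc zero) (suc zero) = sym h11
  SP-prefix (suc d) M<n = SP-step d M<n (SP-prefix d (<⇒≤ M<n))

  SP-realizes : 2 ≤ n → Σ (List (Edge n)) λ es → SP n es × Realizes es h
  SP-realizes 2≤n = up-to n 2≤n ≤-refl
    where
    up-to : ∀ m → 2 ≤ m → m ≤ n → Σ (List (Edge m)) λ es → SP m es × Realizes es h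
    up-to (suc zero)    (s≤s ()) _
    up-to (suc (suc d)) _        m≤n = SP-prefix d m≤n

-- Position 0 is the apex and position i + 1 the tree vertex i, so that tree parents come earlier.
module BOrdering (k : ℕ) where

  n : ℕ
  n = 2 ^ k + 1

  n≡1+2^k : n ≡ suc (2 ^ k)
  n≡1+2^k = +-comm (2 ^ k) 1

  vertexAt : ℕ → Fin n
  vertexAt zero    = apex k
  vertexAt (suc i) with i <? 2 ^ k
  ... | yes i<2^k = tree k (fromℕ< i<2^k)
  ... | no _      = apex k

  vertexAt-suc : ∀ i (i<2^k : i < 2 ^ k) → vertexAt (suc i) ≡ tree k (fromℕ< i<2^k)
  vertexAt-suc i i<2^k with i <? 2 ^ k
  ... | yes _     = refl
  ... | no  i≮2^k = ⊥-elim (i≮2^k i<2^k)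

  vertexAt-suc-toℕ : ∀ a → vertexAt (suc (toℕ a)) ≡ tree k a
  vertexAt-suc-toℕ a = trans (vertexAt-suc (toℕ a) (toℕ<n a)) (cong (tree k) (fromℕ<-toℕ a _))

  suc<n : ∀ {i} → i < 2 ^ k → suc i < n
  suc<n {i} i<2^k = subst (suc i <_) (sym n≡1+2^k) (s≤s i<2^k)

  suc<n⁻¹ : ∀ {i} → suc i < n → i < 2 ^ k
  suc<n⁻¹ {i} i+1<n = s≤s⁻¹ (subst (suc i <_) n≡1+2^k i+1<n)

  0<n : 0 < n
  0<n = subst (0 <_) (sym n≡1+2^k) (s≤s z≤n)

  position : Fin n → Fin n
  position x = [ (λ a → fromℕ< (suc<n (toℕ<n a))) , (λ _ → fromℕ< 0<n) ]′ (splitAt (2 ^ k) x)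

  vertexAt-position : ∀ x → vertexAt (toℕ (position x)) ≡ x
  vertexAt-position x with bvertex k x
  ... | isTree a rewrite splitAt-tree k a | toℕ-fromℕ< (suc<n (toℕ<n a)) = vertexAt-suc-toℕ a
  ... | isApex   rewrite splitAt-apex k | toℕ-fromℕ< 0<n = refl

  position-vertexAt : ∀ a → position (vertexAt (toℕ a)) ≡ a
  position-vertexAt a with toℕ a in eq
  ... | zero  rewrite splitAt-apex k = toℕ-injective (trans (toℕ-fromℕ< 0<n) (sym eq))
  ... | suc i with suc<n⁻¹ (subst (_< n) eq (toℕ<n a))
  ...   | i<2^k rewrite vertexAt-suc i i<2^k | splitAt-tree k (fromℕ< i<2^k) =
    toℕ-injective (trans (toℕ-fromℕ< _) (trans (cong suc (toℕ-fromℕ< _)) (sym eq)))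

  relabel : Fin n ↔ Fin n
  relabel = mk↔ₛ′ (vertexAt ∘ toℕ) position vertexAt-position position-vertexAt

  adjacency : ℕ → ℕ → ℕ
  adjacency i j = indicator (B k (vertexAt i) (vertexAt j))

  at-1 : vertexAt 1 ≡ tree k (fromℕ< (m^n>0 2 k))
  at-1 = vertexAt-suc 0 (m^n>0 2 k)

  adjacency-00 : adjacency 0 0 ≡ 0
  adjacency-00 = cong indicator (B-apex-apex k)

  adjacency-01 : adjacency 0 1 ≡ 1
  adjacency-01 = cong indicator (trans (cong (B k (apex k)) at-1) (B-apex-tree k _))

  adjacency-10 : adjacency 1 0 ≡ 1
  adjacency-10 = cong indicator (trans (cong (λ v → B k v (apex k)) at-1) (B-tree-apex k _))

  adjacency-11 : adjacency 1 1 ≡ 0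
  adjacency-11 = cong indicator (trans (cong₂ (B k) at-1 at-1) (trans (B-tree-tree k _ _) (BT-irrefl k _)))

  joined : ∀ m → 2 ≤ m → m < n → Σ ℕ λ p → 1 ≤ p × p < m × JoinedToApexAnd adjacency m p
  joined (suc i) (s≤s 1≤i) i+1<n = suc (toℕ (treeParent k y)) , s≤s z≤n , s≤s parent<i , record
    { apex-edge = cong indicator (trans (cong (λ v → B k v (apex k)) at-i) (B-tree-apex k y))
                , cong indicator (trans (cong (B k (apex k)) at-i) (B-apex-tree k y))
    ; p-edge    = cong indicator (trans (cong₂ (B k) at-i at-p)
                                        (trans (B-tree-tree k _ _) (trans (BT-sym k _ _) parent-edge)))
                , cong indicator (trans (cong₂ (B k) at-p at-i) (trans (B-tree-tree k _ _) parent-edge))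
    ; no-other  = no-other
    }
    where
    i<2^k = suc<n⁻¹ i+1<n
    y = fromℕ< i<2^k

    toℕ-y : toℕ y ≡ i
    toℕ-y = toℕ-fromℕ< i<2^k

    y-nonroot : isZero y ≡ false
    y-nonroot = isZero-pos y (subst (0 <_) (sym toℕ-y) 1≤i)

    parent<i : toℕ (treeParent k y) < i
    parent<i = subst (toℕ (treeParent k y) <_) toℕ-y (toℕ-treeParent-< k y y-nonroot)

    parent-edge : BT k (treeParent k y) y ≡ true
    parent-edge = BT-treeParent k y y-nonroot

    at-i : vertexAt (suc i) ≡ tree k y
    at-i = vertexAt-suc i i<2^k

    at-p : vertexAt (suc (toℕ (treeParent k y))) ≡ tree k (treeParent k y)
    at-p = vertexAt-suc-toℕ (treeParent k y)

    no-other : ∀ j → j ≤ suc i → j ≢ 0 → j ≢ suc (toℕ (treeParent k y)) →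
               adjacency (suc i) j ≡ 0 × adjacency j (suc i) ≡ 0
    no-other zero    _       j≢0 _   = ⊥-elim (j≢0 refl)
    no-other (suc j) j+1≤i+1 _   j≢p =
      cong indicator (trans (cong₂ (B k) at-i at-j) (trans (B-tree-tree k y z) y≁z)) ,
      cong indicator (trans (cong₂ (B k) at-j at-i) (trans (B-tree-tree k z y) (trans (BT-sym k z y) y≁z)))
      where
      j≤i = s≤s⁻¹ j+1≤i+1
      j<2^k = ≤-<-trans j≤i i<2^k
      z = fromℕ< j<2^k
      at-j = vertexAt-suc j j<2^k
      y≁z : BT k y z ≡ false
      y≁z = BT-earlier-non-parent k y z (subst₂ _≤_ (sym (toℕ-fromℕ< j<2^k)) (sym toℕ-y) j≤i)
        (λ z≡py → j≢p (cong suc (trans (sym (toℕ-fromℕ< j<2^k)) (cong toℕ z≡py))))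

  B-isSP : IsSP (B k)
  B-isSP with ApexTree.SP-realizes n adjacency adjacency-00 adjacency-01 adjacency-10 adjacency-11 joined
                (suc<n (m^n>0 2 k))
  ... | es , sp , realizes = es , sp , relabel , realizes

theorem5 : (k : ℕ) → IsSP (B k) × IsBroadcastGraph (B k)
theorem5 k = BOrdering.B-isSP k , B-isBroadcastGraph k
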